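{- Let $q$ be a prime power. (a) Let $m_1,\dotsc,m_r$ be positive integers and let $Y\subseteq\mathbb{P}^b(\mathbb{F}_q)$ be non-empty. Let $g_1,\dotsc,g_r$ be independent uniformly random homogeneous polynomials in $x_0,\dotsc,x_b$ with $\mathbb{F}_q$-coefficients, $\deg g_i=m_i$. Then $\Pr\left[|Y\cap \mathbb{V}(g_1,\dotsc,g_r)|\leq \frac{|Y|}{2q^r}\right]\leq \frac{4q^r}{|Y|}$. (b) The same inequality holds if $Y\subseteq\mathbb{P}^a(\mathbb{F}_q)\times\mathbb{P}^b(\mathbb{F}_q)$ is non-empty and $g_1,\dotsc,g_r$ are independent uniformly random bihomogeneous polynomials with $\mathbb{F}_q$-coefficients of bidegrees $(m_i,m_i')$ with $m_i,m_i'\geq 1$.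
   Context: $\mathbb{V}(g_1,\dotsc,g_r)$ denotes the common zero set of the (bi)homogeneous polynomials $g_1,\dotsc,g_r$ in projective space (resp. product of projective spaces). -}

module Defs where

open import Level using (0ℓ)
open import Algebra.Bundles using (CommutativeRing)
open import Data.Bool using (Bool; true; false; _∧_)
open import Data.Nat as ℕ using (ℕ; zero; suc; _∸_)
open import Data.Fin using (Fin; zero; suc)
open import Data.Vec using (Vec; []; _∷_; lookup; toList)
open import Data.List using (List; []; _∷_; [_]; length; filterᵇ; map; concatMap; zipWith; foldr; upTo; allFin; cartesianProduct)
open import Data.Product using (_×_; _,_; ∃; proj₁; proj₂)
open import Relation.Nullary using (¬_)
open import Relation.Nullary.Decidable using (⌊_⌋)
open import Relation.Binary.Definitions using (Decidable)
open import Relation.Binary.PropositionalEquality using (_≡_)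

record FiniteField : Set₁ where
  field
    commRing : CommutativeRing 0ℓ 0ℓ
  open CommutativeRing commRing public
  field
    _≈?_     : Decidable _≈_
    0≉1      : ¬ (0# ≈ 1#)
    inverse  : ∀ x → ¬ (x ≈ 0#) → ∃ λ y → x * y ≈ 1#
    elems    : List Carrier
    elems-unique : ∀ x → length (filterᵇ (λ e → ⌊ e ≈? x ⌋) elems) ≡ 1

-- all exponent vectors (monomials) of total degree m in n variables,
-- each exactly once
monos : (n m : ℕ) → List (Vec ℕ n)
monos zero zero = [ [] ]
monos zero (suc m) = []
monos (suc n) m = concatMap (λ k → map (k ∷_) (monos n (m ∸ k))) (upTo (suc m))

module _ (F : FiniteField) where
  open FiniteField F using (Carrier; _≈_; _≈?_; _+_; _*_; 0#; 1#; elems)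

  q : ℕ
  q = length elems

  pow : Carrier → ℕ → Carrier
  pow x zero = 1#
  pow x (suc k) = x * pow x k

  monoVal : ∀ {n} → Vec ℕ n → Vec Carrier n → Carrier
  monoVal [] [] = 1#
  monoVal (e ∷ es) (x ∷ xs) = pow x e * monoVal es xs

  -- a homogeneous polynomial of degree m in n variables = its coefficient
  -- vector, indexed by the list monos n m
  HomPoly : ℕ → ℕ → Set
  HomPoly n m = Vec Carrier (length (monos n m))

  evalHom : ∀ {n m} → HomPoly n m → Vec Carrier n → Carrier
  evalHom {n} {m} c x =
    foldr _+_ 0# (zipWith (λ a e → a * monoVal e x) (toList c) (monos n m))

  -- bihomogeneous polynomial of bidegree (m , m') in variables
  -- x (n of them) and y (n' of them): coefficients indexed by pairs of monomials
  biMonos : (n m n' m' : ℕ) → List (Vec ℕ n × Vec ℕ n')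
  biMonos n m n' m' = cartesianProduct (monos n m) (monos n' m')

  BiHomPoly : ℕ → ℕ → ℕ → ℕ → Set
  BiHomPoly n m n' m' = Vec Carrier (length (biMonos n m n' m'))

  evalBi : ∀ {n m n' m'} → BiHomPoly n m n' m' → Vec Carrier n → Vec Carrier n' → Carrier
  evalBi {n} {m} {n'} {m'} c x y =
    foldr _+_ 0# (zipWith (λ a e → a * (monoVal (proj₁ e) x * monoVal (proj₂ e) y))
                          (toList c) (biMonos n m n' m'))

  allVecs : (k : ℕ) → List (Vec Carrier k)
  allVecs zero = [ [] ]
  allVecs (suc k) = concatMap (λ c → map (c ∷_) (allVecs k)) elems

  consT : ∀ {r} {D : Fin (suc r) → ℕ} → Vec Carrier (D zero) →
          ((i : Fin r) → Vec Carrier (D (suc i))) → (i : Fin (suc r)) → Vec Carrier (D i)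
  consT v t zero = v
  consT v t (suc i) = t i

  -- all r-tuples of coefficient vectors (the finite uniform sample space)
  allTuples : (r : ℕ) (D : Fin r → ℕ) → List ((i : Fin r) → Vec Carrier (D i))
  allTuples zero D = [ (λ ()) ]
  allTuples (suc r) D =
    concatMap (λ v → map (λ t → consT {D = D} v t) (allTuples r (λ i → D (suc i))))
              (allVecs (D zero))

  isZero : Carrier → Bool
  isZero x = ⌊ x ≈? 0# ⌋

  -- projective points: nonzero vectors; two represent the same point iff proportional
  NonZeroVec : ∀ {n} → Vec Carrier n → Set
  NonZeroVec {n} v = ¬ (∀ (i : Fin n) → lookup v i ≈ 0#)

  Proportional : ∀ {n} → Vec Carrier n → Vec Carrier n → Set
  Proportional {n} v w = ∃ λ c → ¬ (c ≈ 0#) × (∀ (i : Fin n) → lookup w i ≈ c * lookup v i)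

  count : {A : Set} → (A → Bool) → List A → ℕ
  count p xs = length (filterᵇ p xs)

allIdx : (r : ℕ) → (Fin r → Bool) → Bool
allIdx r p = foldr _∧_ true (map p (allFin r))

{-# OPTIONS --safe #-}

-- Let N(g) be the number of points of Y on V(g₁, …, g_r), g ranging over all r-tuples of coefficient
-- vectors. Evaluation at a point y is a linear form in the coefficients, given by the values of the
-- monomials at y (the Veronese vector of y), and this form is nonzero. For two distinct points the two
-- Veronese vectors have a non-vanishing 2 × 2 minor; in the bihomogeneous case they are tensor products,
-- and such a minor survives. So each point lies on V(g) for a proportion q⁻ʳ of all g and any two points
-- for a proportion q⁻²ʳ: the events are pairwise independent. Hence E N = |Y|/qʳ and Var N ≤ E N, and
-- Chebyshev's inequality gives Pr[N ≤ E N / 2] ≤ 4 Var N / (E N)² ≤ 4 qʳ / |Y|.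

module Submission where

open import Defs

open import Data.Bool using (Bool; true; false; _∧_; T)
open import Data.Empty using (⊥-elim)
open import Data.Fin using (Fin; zero; suc)
open import Data.List using (List; []; _∷_; length; filterᵇ; map; concatMap; _++_; foldr; zipWith; cartesianProduct)
open import Data.List.Relation.Unary.All as All using (All; []; _∷_)
open import Data.List.Relation.Unary.AllPairs as AllPairs using (AllPairs; []; _∷_)
open import Data.List.Relation.Unary.Any using (Any; here; there)
open import Data.List.Membership.Propositional using (_∈_; find; lose)
open import Data.Product using (_×_; _,_; ∃; ∃₂; proj₁; proj₂)
open import Data.Sum using (_⊎_; inj₁; inj₂)
open import Data.Vec using (Vec; []; _∷_; toList; lookup; replicate; updateAt)
open import Algebra.Bundles using (CommutativeRing)
open import Function using (_∘_; id)
open import Relation.Nullary using (¬_; yes; no)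
open import Relation.Nullary.Decidable using (⌊_⌋)

module Sums where

  open import Data.Nat using (ℕ; suc; _+_; _*_; _≤_; z≤n)
  open import Data.Nat.Properties
  open import Algebra.Properties.CommutativeSemigroup +-commutativeSemigroup using (interchange)
  open import Relation.Binary.PropositionalEquality

  ∑ : {A : Set} → List A → (A → ℕ) → ℕ
  ∑ []       f = 0
  ∑ (x ∷ xs) f = f x + ∑ xs f

  infix 5 ∑
  syntax ∑ xs (λ x → e) = ∑[ x ∈ xs ] e

  𝟙 : Bool → ℕ
  𝟙 true  = 1
  𝟙 false = 0

  𝟙-∧ : ∀ a b → 𝟙 (a ∧ b) ≡ 𝟙 a * 𝟙 b
  𝟙-∧ true  b = sym (+-identityʳ (𝟙 b))
  𝟙-∧ false b = refl

  module _ {A : Set} where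

    length-filterᵇ : (p : A → Bool) (xs : List A) → length (filterᵇ p xs) ≡ ∑[ x ∈ xs ] 𝟙 (p x)
    length-filterᵇ p []       = refl
    length-filterᵇ p (x ∷ xs) with p x
    ... | true  = cong suc (length-filterᵇ p xs)
    ... | false = length-filterᵇ p xs

    ∑-1 : (xs : List A) → ∑ xs (λ _ → 1) ≡ length xs
    ∑-1 []       = refl
    ∑-1 (x ∷ xs) = cong suc (∑-1 xs)

    ∑-cong : {f g : A → ℕ} → (∀ x → f x ≡ g x) → ∀ xs → ∑ xs f ≡ ∑ xs g
    ∑-cong f≗g []       = refl
    ∑-cong f≗g (x ∷ xs) = cong₂ _+_ (f≗g x) (∑-cong f≗g xs)

    ∑-++ : ∀ xs ys (f : A → ℕ) → ∑ (xs ++ ys) f ≡ ∑ xs f + ∑ ys f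
    ∑-++ []       ys f = refl
    ∑-++ (x ∷ xs) ys f = trans (cong (f x +_) (∑-++ xs ys f)) (sym (+-assoc (f x) _ _))

    ∑-+ : ∀ xs (f g : A → ℕ) → ∑[ x ∈ xs ] (f x + g x) ≡ ∑ xs f + ∑ xs g
    ∑-+ []       f g = refl
    ∑-+ (x ∷ xs) f g = trans (cong (f x + g x +_) (∑-+ xs f g)) (interchange (f x) (g x) _ _)

    ∑-*ˡ : ∀ c xs (f : A → ℕ) → ∑[ x ∈ xs ] (c * f x) ≡ c * ∑ xs f
    ∑-*ˡ c []       f = sym (*-zeroʳ c)
    ∑-*ˡ c (x ∷ xs) f = trans (cong (c * f x +_) (∑-*ˡ c xs f)) (sym (*-distribˡ-+ c (f x) _))

    ∑-*ʳ : ∀ c xs (f : A → ℕ) → ∑[ x ∈ xs ] (f x * c) ≡ ∑ xs f * c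
    ∑-*ʳ c xs f = trans (∑-cong (λ x → *-comm (f x) c) xs) (trans (∑-*ˡ c xs f) (*-comm c _))

    ∑-const : ∀ c (xs : List A) → ∑ xs (λ _ → c) ≡ c * length xs
    ∑-const c []       = sym (*-zeroʳ c)
    ∑-const c (x ∷ xs) = trans (cong (c +_) (∑-const c xs)) (sym (*-suc c _))

    ∑-All-const : ∀ {f : A → ℕ} {c xs} → All (λ x → f x ≡ c) xs → ∑ xs f ≡ c * length xs
    ∑-All-const {c = c} []           = sym (*-zeroʳ c)
    ∑-All-const {c = c} (fx≡c ∷ f≡c) = trans (cong₂ _+_ fx≡c (∑-All-const f≡c)) (sym (*-suc c _))

    ∑-mono-≤ : {f g : A → ℕ} → (∀ x → f x ≤ g x) → ∀ xs → ∑ xs f ≤ ∑ xs g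
    ∑-mono-≤ f≤g []       = z≤n
    ∑-mono-≤ f≤g (x ∷ xs) = +-mono-≤ (f≤g x) (∑-mono-≤ f≤g xs)

  module _ {A B : Set} where

    ∑-map : ∀ (g : A → B) xs (f : B → ℕ) → ∑ (map g xs) f ≡ ∑[ x ∈ xs ] f (g x)
    ∑-map g []       f = refl
    ∑-map g (x ∷ xs) f = cong (f (g x) +_) (∑-map g xs f)

    ∑-concatMap : ∀ (g : A → List B) xs (f : B → ℕ) → ∑ (concatMap g xs) f ≡ ∑[ x ∈ xs ] ∑ (g x) f
    ∑-concatMap g []       f = refl
    ∑-concatMap g (x ∷ xs) f = trans (∑-++ (g x) _ f) (cong (∑ (g x) f +_) (∑-concatMap g xs f))

    ∑-comm : ∀ xs ys (f : A → B → ℕ) → ∑[ x ∈ xs ] ∑[ y ∈ ys ] f x y ≡ ∑[ y ∈ ys ] ∑[ x ∈ xs ] f x y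
    ∑-comm []       ys f = sym (∑-const 0 ys)
    ∑-comm (x ∷ xs) ys f =
      trans (cong (∑ ys (f x) +_) (∑-comm xs ys f)) (sym (∑-+ ys (f x) (λ y → ∑[ x ∈ xs ] f x y)))

module SecondMoment where

  open import Data.Nat
  open import Data.Nat.Properties
  open import Data.Nat.Tactic.RingSolver using (solve-∀)
  open import Relation.Binary.PropositionalEquality
  open Sums

  private
    ∣m-n∣²+2mn≡m²+n²-ordered : ∀ {m n} → m ≤ n → ∣ m - n ∣ * ∣ m - n ∣ + 2 * (m * n) ≡ m * m + n * n
    ∣m-n∣²+2mn≡m²+n²-ordered {m} m≤n with m≤n⇒∃[o]m+o≡n m≤n
    ... | k , refl rewrite ∣m-m+n∣≡n m k = identity m k
      where
      identity : ∀ m k → k * k + 2 * (m * (m + k)) ≡ m * m + (m + k) * (m + k)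
      identity = solve-∀

  ∣m-n∣²+2mn≡m²+n² : ∀ m n → ∣ m - n ∣ * ∣ m - n ∣ + 2 * (m * n) ≡ m * m + n * n
  ∣m-n∣²+2mn≡m²+n² m n with ≤-total m n
  ... | inj₁ m≤n = ∣m-n∣²+2mn≡m²+n²-ordered m≤n
  ... | inj₂ n≤m rewrite ∣-∣-comm m n | *-comm m n | +-comm (m * m) (n * n) =
    ∣m-n∣²+2mn≡m²+n²-ordered n≤m

  2n≤m⇒m≤2∣m-n∣ : ∀ {m n} → 2 * n ≤ m → m ≤ 2 * ∣ m - n ∣
  2n≤m⇒m≤2∣m-n∣ {m} {n} 2n≤m with m≤n⇒∃[o]m+o≡n (≤-trans (m≤m+n n (n + 0)) 2n≤m)
  ... | k , refl rewrite ∣-∣-comm (n + k) n | ∣m-m+n∣≡n n k | +-identityʳ k =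
    +-monoˡ-≤ k (+-cancelˡ-≤ n n k (subst (_≤ n + k) (cong (n +_) (+-identityʳ n)) 2n≤m))

  𝟙[2n≤m]*m²≤4∣m-n∣² : ∀ m n → 𝟙 (2 * n ≤ᵇ m) * (m * m) ≤ 4 * (∣ m - n ∣ * ∣ m - n ∣)
  𝟙[2n≤m]*m²≤4∣m-n∣² m n with 2 * n ≤ᵇ m in 2n≤ᵇm
  ... | false = z≤n
  ... | true  = begin
    1 * (m * m)         ≡⟨ *-identityˡ (m * m) ⟩
    m * m               ≤⟨ *-mono-≤ m≤2d m≤2d ⟩
    (2 * d) * (2 * d)   ≡⟨ [2d]²≡4d² d ⟩
    4 * (d * d)         ∎
    where
    open ≤-Reasoning
    d = ∣ m - n ∣
    m≤2d : m ≤ 2 * d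
    m≤2d = 2n≤m⇒m≤2∣m-n∣ (≤ᵇ⇒≤ (2 * n) m (subst T (sym 2n≤ᵇm) _))
    [2d]²≡4d² : ∀ d → (2 * d) * (2 * d) ≡ 4 * (d * d)
    [2d]²≡4d² = solve-∀

  module _ {G P : Set} (S : List G) (A : P → G → Bool) (K : ℕ) where

    hits : List P → G → ℕ
    hits Y g = ∑[ p ∈ Y ] 𝟙 (A p g)

    joint : P → P → ℕ
    joint p p′ = ∑[ g ∈ S ] 𝟙 (A p g ∧ A p′ g)

    Pr≡1/K : P → Set
    Pr≡1/K p = (∑[ g ∈ S ] 𝟙 (A p g)) * K ≡ length S

    Pr≡1/K² : P → P → Set
    Pr≡1/K² p p′ = joint p p′ * (K * K) ≡ length S

    private
      M = length S

    ∑hits*K : ∀ Y → All Pr≡1/K Y → (∑[ g ∈ S ] hits Y g) * K ≡ M * length Y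
    ∑hits*K Y pr = begin
      (∑[ g ∈ S ] ∑[ p ∈ Y ] 𝟙 (A p g)) * K  ≡⟨ cong (_* K) (∑-comm S Y (λ g p → 𝟙 (A p g))) ⟩
      (∑[ p ∈ Y ] ∑[ g ∈ S ] 𝟙 (A p g)) * K  ≡⟨ ∑-*ʳ K Y (λ p → ∑[ g ∈ S ] 𝟙 (A p g)) ⟨
      ∑[ p ∈ Y ] (∑[ g ∈ S ] 𝟙 (A p g)) * K  ≡⟨ ∑-All-const pr ⟩
      M * length Y                           ∎
      where open ≡-Reasoning

    ∑hits²≡∑joint : ∀ Y → ∑[ g ∈ S ] hits Y g * hits Y g ≡ ∑[ p ∈ Y ] ∑[ p′ ∈ Y ] joint p p′
    ∑hits²≡∑joint Y = begin
      ∑[ g ∈ S ] hits Y g * hits Y g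
        ≡⟨ ∑-cong (λ g → square g) S ⟩
      ∑[ g ∈ S ] ∑[ p ∈ Y ] ∑[ p′ ∈ Y ] 𝟙 (A p g ∧ A p′ g)
        ≡⟨ ∑-comm S Y _ ⟩
      ∑[ p ∈ Y ] ∑[ g ∈ S ] ∑[ p′ ∈ Y ] 𝟙 (A p g ∧ A p′ g)
        ≡⟨ ∑-cong (λ p → ∑-comm S Y _) Y ⟩
      ∑[ p ∈ Y ] ∑[ p′ ∈ Y ] joint p p′ ∎
      where
      open ≡-Reasoning
      square : ∀ g → hits Y g * hits Y g ≡ ∑[ p ∈ Y ] ∑[ p′ ∈ Y ] 𝟙 (A p g ∧ A p′ g)
      square g = trans (sym (∑-*ʳ (hits Y g) Y (λ p → 𝟙 (A p g))))
        (∑-cong (λ p → trans (sym (∑-*ˡ (𝟙 (A p g)) Y (λ p′ → 𝟙 (A p′ g))))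
                             (∑-cong (λ p′ → sym (𝟙-∧ (A p g) (A p′ g))) Y)) Y)

    -- Diagonal terms contribute M K each and off-diagonal ones M: the sum is M E K + M E (E − 1).
    ∑joint*K² : ∀ Y → All Pr≡1/K Y → AllPairs Pr≡1/K² Y →
      (∑[ p ∈ Y ] ∑[ p′ ∈ Y ] joint p p′) * (K * K) + M * length Y ≡ M * length Y * K + M * length Y * length Y
    ∑joint*K² []       []          []          rewrite *-zeroʳ M = refl
    ∑joint*K² (p ∷ Y) (pr ∷ prs) (pr² ∷ pr²s) = begin
      (a + row + (∑[ x ∈ Y ] (joint x p + ∑ Y (joint x)))) * K² + M * suc E
        ≡⟨ cong (λ z → (a + row + z) * K² + M * suc E) (∑-+ Y (λ x → joint x p) (λ x → ∑ Y (joint x))) ⟩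
      (a + row + (col + rest)) * K² + M * suc E
        ≡⟨ rearrange a row col rest K² M E ⟩
      a * K² + row * K² + col * K² + (rest * K² + M * E) + M
        ≡⟨ cong₂ (λ u v → u + v + M) (cong₂ _+_ (cong₂ _+_ diagonal rowSum) colSum) (∑joint*K² Y prs pr²s) ⟩
      M * K + M * E + M * E + (M * E * K + M * E * E) + M
        ≡⟨ collect M E K ⟩
      M * suc E * K + M * suc E * suc E ∎
      where
      open ≡-Reasoning
      K² = K * K
      E = length Y
      a = joint p p
      row = ∑[ p′ ∈ Y ] joint p p′
      col = ∑[ x ∈ Y ] joint x p
      rest = ∑[ x ∈ Y ] ∑[ p′ ∈ Y ] joint x p′
      rearrange : ∀ a b c d k m e → (a + b + (c + d)) * k + m * suc e ≡ a * k + b * k + c * k + (d * k + m * e) + m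
      rearrange = solve-∀
      collect : ∀ m e k → m * k + m * e + m * e + (m * e * k + m * e * e) + m ≡ m * suc e * k + m * suc e * suc e
      collect = solve-∀
      diagonal : a * K² ≡ M * K
      diagonal = begin
        a * K²                               ≡⟨ cong (_* K²) (∑-cong (λ g → cong 𝟙 (∧-idem (A p g))) S) ⟩
        (∑[ g ∈ S ] 𝟙 (A p g)) * (K * K)     ≡⟨ *-assoc (∑[ g ∈ S ] 𝟙 (A p g)) K K ⟨
        (∑[ g ∈ S ] 𝟙 (A p g)) * K * K       ≡⟨ cong (_* K) pr ⟩
        M * K                                ∎
        where open import Data.Bool.Properties using (∧-idem)
      rowSum : row * K² ≡ M * E
      rowSum = trans (sym (∑-*ʳ K² Y (joint p))) (∑-All-const pr²)
      colSum : col * K² ≡ M * E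
      colSum = trans (sym (∑-*ʳ K² Y (λ x → joint x p)))
        (∑-All-const (All.map (λ {x} h → trans (cong (_* K²) (∑-cong (λ g → cong 𝟙 (∧-comm (A x g) (A p g))) S)) h) pr²))
        where open import Data.Bool.Properties using (∧-comm)

    gap : List P → G → ℕ
    gap Y g = ∣ length Y - K * hits Y g ∣

    ∑gap²-expansion : ∀ Y → (∑[ g ∈ S ] gap Y g * gap Y g) + 2 * length Y * (K * ∑ S (hits Y))
                            ≡ length Y * length Y * M + K * K * (∑[ g ∈ S ] hits Y g * hits Y g)
    ∑gap²-expansion Y = begin
      D + 2 * E * (K * ∑ S N)
        ≡⟨ cong (D +_) (trans (cong (2 * E *_) (sym (∑-*ˡ K S N))) (sym (∑-*ˡ (2 * E) S (λ g → K * N g)))) ⟩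
      D + (∑[ g ∈ S ] 2 * E * (K * N g))
        ≡⟨ ∑-+ S (λ g → gap Y g * gap Y g) (λ g → 2 * E * (K * N g)) ⟨
      ∑[ g ∈ S ] (gap Y g * gap Y g + 2 * E * (K * N g))
        ≡⟨ ∑-cong (λ g → trans (cong (gap Y g * gap Y g +_) (*-assoc 2 E _)) (∣m-n∣²+2mn≡m²+n² E (K * N g))) S ⟩
      ∑[ g ∈ S ] (E * E + K * N g * (K * N g))
        ≡⟨ ∑-+ S (λ _ → E * E) (λ g → K * N g * (K * N g)) ⟩
      ∑ S (λ _ → E * E) + (∑[ g ∈ S ] K * N g * (K * N g))
        ≡⟨ cong₂ _+_ (∑-const (E * E) S) (trans (∑-cong (λ g → square K (N g)) S) (∑-*ˡ (K * K) S (λ g → N g * N g))) ⟩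
      E * E * M + K * K * (∑[ g ∈ S ] N g * N g) ∎
      where
      open ≡-Reasoning
      E = length Y
      N = hits Y
      D = ∑[ g ∈ S ] gap Y g * gap Y g
      square : ∀ k n → k * n * (k * n) ≡ k * k * (n * n)
      square = solve-∀

    ∑gap²+ME≡MEK : ∀ Y → All Pr≡1/K Y → AllPairs Pr≡1/K² Y →
      (∑[ g ∈ S ] gap Y g * gap Y g) + M * length Y ≡ M * length Y * K
    ∑gap²+ME≡MEK Y pr pr² = +-cancelʳ-≡ (2 * E * (M * E)) _ _ (begin
      D + M * E + 2 * E * (M * E)          ≡⟨ shuffle D (M * E) (2 * E) ⟩
      D + 2 * E * (M * E) + M * E          ≡⟨ cong (λ x → D + 2 * E * x + M * E) (trans (sym (∑hits*K Y pr)) (*-comm _ K)) ⟩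
      D + 2 * E * (K * ∑ S (hits Y)) + M * E
        ≡⟨ cong (_+ M * E) (∑gap²-expansion Y) ⟩
      E * E * M + K * K * N² + M * E
        ≡⟨ cong (λ x → E * E * M + x + M * E) (trans (*-comm (K * K) N²) (cong (_* (K * K)) (∑hits²≡∑joint Y))) ⟩
      E * E * M + (∑[ p ∈ Y ] ∑[ p′ ∈ Y ] joint p p′) * (K * K) + M * E
        ≡⟨ trans (+-assoc (E * E * M) _ _) (cong (E * E * M +_) (∑joint*K² Y pr pr²)) ⟩
      E * E * M + (M * E * K + M * E * E)  ≡⟨ regroup M E K ⟩
      M * E * K + 2 * E * (M * E)          ∎)
      where
      open ≡-Reasoning
      E = length Y
      D = ∑[ g ∈ S ] gap Y g * gap Y g
      N² = ∑[ g ∈ S ] hits Y g * hits Y g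
      shuffle : ∀ d x y → d + x + y * x ≡ d + y * x + x
      shuffle = solve-∀
      regroup : ∀ m e k → e * e * m + (m * e * k + m * e * e) ≡ m * e * k + 2 * e * (m * e)
      regroup = solve-∀

    second-moment-method : ∀ Y → All Pr≡1/K Y → AllPairs Pr≡1/K² Y → 1 ≤ length Y →
      (∑[ g ∈ S ] 𝟙 (2 * K * hits Y g ≤ᵇ length Y)) * length Y ≤ 4 * K * M
    second-moment-method Y@(_ ∷ _) pr pr² _ = *-cancelʳ-≤ _ _ E (begin
      B * E * E                                          ≡⟨ *-assoc B E E ⟩
      B * (E * E)                                        ≡⟨ ∑-*ʳ (E * E) S bad ⟨
      ∑[ g ∈ S ] bad g * (E * E)
        ≡⟨ ∑-cong (λ g → cong (λ x → 𝟙 (x ≤ᵇ E) * (E * E)) (*-assoc 2 K (hits Y g))) S ⟩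
      ∑[ g ∈ S ] 𝟙 (2 * (K * hits Y g) ≤ᵇ E) * (E * E)
        ≤⟨ ∑-mono-≤ (λ g → 𝟙[2n≤m]*m²≤4∣m-n∣² E (K * hits Y g)) S ⟩
      ∑[ g ∈ S ] 4 * (gap Y g * gap Y g)                 ≡⟨ ∑-*ˡ 4 S (λ g → gap Y g * gap Y g) ⟩
      4 * (∑[ g ∈ S ] gap Y g * gap Y g)                 ≤⟨ *-monoʳ-≤ 4 ∑gap²≤MEK ⟩
      4 * (M * E * K)                                    ≡⟨ regroup M E K ⟩
      4 * K * M * E                                      ∎)
      where
      open ≤-Reasoning
      E = length Y
      bad : G → ℕ
      bad g = 𝟙 (2 * K * hits Y g ≤ᵇ E)
      B = ∑ S bad
      ∑gap²≤MEK : (∑[ g ∈ S ] gap Y g * gap Y g) ≤ M * E * K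
      ∑gap²≤MEK = subst ((∑[ g ∈ S ] gap Y g * gap Y g) ≤_) (∑gap²+ME≡MEK Y pr pr²) (m≤m+n _ (M * E))
      regroup : ∀ m e k → 4 * (m * e * k) ≡ 4 * k * m * e
      regroup = solve-∀

module CommutativeRingIdentities {c ℓ} (R : CommutativeRing c ℓ) where

  open import Data.Maybe using (nothing)
  open import Tactic.RingSolver.Core.AlmostCommutativeRing using (AlmostCommutativeRing; fromCommutativeRing)
  import Tactic.RingSolver as RingSolver

  private
    ring : AlmostCommutativeRing c ℓ
    ring = fromCommutativeRing R (λ _ → nothing)

  open AlmostCommutativeRing ring

  x+yz+yw≈x+y[z+w] : ∀ x y z w → x + y * z + y * w ≈ x + y * (z + w)
  x+yz+yw≈x+y[z+w] = RingSolver.solve-∀ ring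

  x[yz]+yw≈y[xz+w] : ∀ x y z w → x * (y * z) + y * w ≈ y * (x * z + w)
  x[yz]+yw≈y[xz+w] = RingSolver.solve-∀ ring

  x[y+z]+w≈xy+w+xz : ∀ x y z w → x * (y + z) + w ≈ x * y + w + x * z
  x[y+z]+w≈xy+w+xz = RingSolver.solve-∀ ring

  a[u′+xb]+bu≈au′+b[u+xa] : ∀ a b u u′ x → a * (u′ + x * b) + b * u ≈ a * u′ + b * (u + x * a)
  a[u′+xb]+bu≈au′+b[u+xa] = RingSolver.solve-∀ ring

module AffineEquations (F : FiniteField) where

  import Relation.Binary.Reasoning.Setoid

  open import Data.Nat as ℕ using (ℕ)
  import Data.Nat.Properties as ℕ
  import Relation.Binary.PropositionalEquality as ≡
  open ≡ using (_≡_)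
  open Sums
  open FiniteField F
  open import Algebra.Properties.Group +-group using (∙-cancelˡ; ∙-cancelʳ; x∙y⁻¹≈ε⇒x≈y; //-rightDividesˡ)
  open CommutativeRingIdentities commRing

  private
    module ≈-Reasoning = Relation.Binary.Reasoning.Setoid setoid

  ⟦_≈_⟧ : Carrier → Carrier → ℕ
  ⟦ x ≈ y ⟧ = 𝟙 ⌊ x ≈? y ⌋

  ⟦⟧-⇔ : ∀ {x y x′ y′} → (x ≈ y → x′ ≈ y′) → (x′ ≈ y′ → x ≈ y) → ⟦ x ≈ y ⟧ ≡ ⟦ x′ ≈ y′ ⟧
  ⟦⟧-⇔ {x} {y} {x′} {y′} to from with x ≈? y | x′ ≈? y′
  ... | yes _   | yes _    = ≡.refl
  ... | no _    | no _     = ≡.refl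
  ... | yes x≈y | no x′≉y′ = ⊥-elim (x′≉y′ (to x≈y))
  ... | no x≉y  | yes x′≈y′ = ⊥-elim (x≉y (from x′≈y′))

  ⟦⟧-resp : ∀ {x y x′ y′} → x ≈ x′ → y ≈ y′ → ⟦ x ≈ y ⟧ ≡ ⟦ x′ ≈ y′ ⟧
  ⟦⟧-resp x≈x′ y≈y′ = ⟦⟧-⇔ (λ x≈y → trans (sym x≈x′) (trans x≈y y≈y′))
                            (λ x′≈y′ → trans x≈x′ (trans x′≈y′ (sym y≈y′)))

  ⟦⟧-+ˡ : ∀ z {x y} → ⟦ z + x ≈ z + y ⟧ ≡ ⟦ x ≈ y ⟧
  ⟦⟧-+ˡ z = ⟦⟧-⇔ (∙-cancelˡ z _ _) +-congˡ

  ⟦⟧-+ʳ : ∀ z {x y} → ⟦ x + z ≈ y + z ⟧ ≡ ⟦ x ≈ y ⟧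
  ⟦⟧-+ʳ z = ⟦⟧-⇔ (∙-cancelʳ z _ _) +-congʳ

  ∑⟦a≈x⟧≡1 : ∀ x → ∑[ a ∈ elems ] ⟦ a ≈ x ⟧ ≡ 1
  ∑⟦a≈x⟧≡1 x = ≡.trans (≡.sym (length-filterᵇ (λ a → ⌊ a ≈? x ⌋) elems)) (elems-unique x)

  _⁻¹[_] : ∀ α → α ≉ 0# → Carrier
  α ⁻¹[ α≉0 ] = proj₁ (inverse α α≉0)

  ⁻¹-inverseʳ : ∀ {α} (α≉0 : α ≉ 0#) → α * α ⁻¹[ α≉0 ] ≈ 1#
  ⁻¹-inverseʳ {α} α≉0 = proj₂ (inverse α α≉0)

  *-cancelʳ-≉0 : ∀ {α} → α ≉ 0# → ∀ {x y} → x * α ≈ y * α → x ≈ y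
  *-cancelʳ-≉0 {α} α≉0 {x} {y} xα≈yα = begin
    x                ≈⟨ *-identityʳ x ⟨
    x * 1#           ≈⟨ *-congˡ αα⁻¹≈1 ⟨
    x * (α * α⁻¹)    ≈⟨ *-assoc x α α⁻¹ ⟨
    x * α * α⁻¹      ≈⟨ *-congʳ xα≈yα ⟩
    y * α * α⁻¹      ≈⟨ *-assoc y α α⁻¹ ⟩
    y * (α * α⁻¹)    ≈⟨ *-congˡ αα⁻¹≈1 ⟩
    y * 1#           ≈⟨ *-identityʳ y ⟩
    y                ∎
    where
    α⁻¹ = α ⁻¹[ α≉0 ]
    αα⁻¹≈1 = ⁻¹-inverseʳ α≉0
    open ≈-Reasoning

  *-≉0 : ∀ {x y} → x ≉ 0# → y ≉ 0# → x * y ≉ 0#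
  *-≉0 {x} {y} x≉0 y≉0 xy≈0 = x≉0 (*-cancelʳ-≉0 y≉0 (trans xy≈0 (sym (zeroˡ y))))

  ⟦⟧-*ʳ : ∀ {α} → α ≉ 0# → ∀ {x y} → ⟦ x * α ≈ y * α ⟧ ≡ ⟦ x ≈ y ⟧
  ⟦⟧-*ʳ α≉0 = ⟦⟧-⇔ (*-cancelʳ-≉0 α≉0) *-congʳ

  root : ∀ {α} → α ≉ 0# → Carrier → Carrier → Carrier
  root {α} α≉0 u t = (t - u) * α ⁻¹[ α≉0 ]

  root-solves : ∀ {α} (α≉0 : α ≉ 0#) u t → u + root α≉0 u t * α ≈ t
  root-solves {α} α≉0 u t = begin
    u + (t - u) * α⁻¹ * α    ≈⟨ +-congˡ (*-assoc (t - u) α⁻¹ α) ⟩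
    u + (t - u) * (α⁻¹ * α)  ≈⟨ +-congˡ (*-congˡ (trans (*-comm α⁻¹ α) (⁻¹-inverseʳ α≉0))) ⟩
    u + (t - u) * 1#         ≈⟨ +-congˡ (*-identityʳ (t - u)) ⟩
    u + (t - u)              ≈⟨ +-comm u (t - u) ⟩
    (t - u) + u              ≈⟨ //-rightDividesˡ u t ⟩
    t                        ∎
    where
    α⁻¹ = α ⁻¹[ α≉0 ]
    open ≈-Reasoning

  ⟦u+aα≈t⟧≡⟦a≈root⟧ : ∀ {α} (α≉0 : α ≉ 0#) u t a → ⟦ u + a * α ≈ t ⟧ ≡ ⟦ a ≈ root α≉0 u t ⟧
  ⟦u+aα≈t⟧≡⟦a≈root⟧ {α} α≉0 u t a = begin
    ⟦ u + a * α ≈ t ⟧                    ≡⟨ ⟦⟧-resp refl (sym (root-solves α≉0 u t)) ⟩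
    ⟦ u + a * α ≈ u + root α≉0 u t * α ⟧ ≡⟨ ⟦⟧-+ˡ u ⟩
    ⟦ a * α ≈ root α≉0 u t * α ⟧         ≡⟨ ⟦⟧-*ʳ α≉0 ⟩
    ⟦ a ≈ root α≉0 u t ⟧                 ∎
    where open ≡.≡-Reasoning

  ∑⟦u+aα≈t⟧≡1 : ∀ {α} → α ≉ 0# → ∀ u t → ∑[ a ∈ elems ] ⟦ u + a * α ≈ t ⟧ ≡ 1
  ∑⟦u+aα≈t⟧≡1 α≉0 u t =
    ≡.trans (∑-cong (⟦u+aα≈t⟧≡⟦a≈root⟧ α≉0 u t) elems) (∑⟦a≈x⟧≡1 (root α≉0 u t))

  ∑⟦u+aα≈u′+aβ⟧≡1 : ∀ {α β} → α ≉ β → ∀ u u′ → ∑[ a ∈ elems ] ⟦ u + a * α ≈ u′ + a * β ⟧ ≡ 1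
  ∑⟦u+aα≈u′+aβ⟧≡1 {α} {β} α≉β u u′ =
    ≡.trans (∑-cong to-difference elems) (∑⟦u+aα≈t⟧≡1 α-β≉0 u u′)
    where
    α-β≉0 : α - β ≉ 0#
    α-β≉0 α-β≈0 = α≉β (x∙y⁻¹≈ε⇒x≈y α β α-β≈0)
    to-difference : ∀ a → ⟦ u + a * α ≈ u′ + a * β ⟧ ≡ ⟦ u + a * (α - β) ≈ u′ ⟧
    to-difference a = ≡.trans (⟦⟧-resp split refl) (⟦⟧-+ʳ (a * β))
      where
      split : u + a * α ≈ u + a * (α - β) + a * β
      split = sym (trans (x+yz+yw≈x+y[z+w] u a (α - β) β) (+-congˡ (*-congˡ (//-rightDividesˡ β α))))

  -- Once the first equation fixes a, the second holds iff the 2 × 2 determinant condition does.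
  ∑⟦u+aα≈t⟧⟦u′+aβ≈t′⟧ : ∀ {α} → α ≉ 0# → ∀ β u u′ t t′ →
    ∑[ a ∈ elems ] ⟦ u + a * α ≈ t ⟧ ℕ.* ⟦ u′ + a * β ≈ t′ ⟧ ≡ ⟦ α * u′ + β * t ≈ α * t′ + β * u ⟧
  ∑⟦u+aα≈t⟧⟦u′+aβ≈t′⟧ {α} α≉0 β u u′ t t′ = begin
    ∑[ a ∈ elems ] ⟦ u + a * α ≈ t ⟧ ℕ.* ⟦ u′ + a * β ≈ t′ ⟧
      ≡⟨ ∑-cong (λ a → ≡.trans (≡.cong (ℕ._* _) (⟦u+aα≈t⟧≡⟦a≈root⟧ α≉0 u t a)) (at-root a)) elems ⟩
    ∑[ a ∈ elems ] ⟦ a ≈ x ⟧ ℕ.* ⟦ u′ + x * β ≈ t′ ⟧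
      ≡⟨ ∑-*ʳ _ elems (λ a → ⟦ a ≈ x ⟧) ⟩
    (∑[ a ∈ elems ] ⟦ a ≈ x ⟧) ℕ.* ⟦ u′ + x * β ≈ t′ ⟧
      ≡⟨ ≡.trans (≡.cong (ℕ._* ⟦ u′ + x * β ≈ t′ ⟧) (∑⟦a≈x⟧≡1 x)) (ℕ.*-identityˡ _) ⟩
    ⟦ u′ + x * β ≈ t′ ⟧
      ≡⟨ ⟦⟧-*ʳ α≉0 ⟨
    ⟦ (u′ + x * β) * α ≈ t′ * α ⟧
      ≡⟨ ⟦⟧-resp (*-comm _ α) (*-comm t′ α) ⟩
    ⟦ α * (u′ + x * β) ≈ α * t′ ⟧
      ≡⟨ ⟦⟧-+ʳ (β * u) ⟨
    ⟦ α * (u′ + x * β) + β * u ≈ α * t′ + β * u ⟧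
      ≡⟨ ⟦⟧-resp (trans (a[u′+xb]+bu≈au′+b[u+xa] α β u u′ x) (+-congˡ (*-congˡ (root-solves α≉0 u t)))) refl ⟩
    ⟦ α * u′ + β * t ≈ α * t′ + β * u ⟧ ∎
    where
    open ≡.≡-Reasoning
    x = root α≉0 u t
    at-root : ∀ a → ⟦ a ≈ x ⟧ ℕ.* ⟦ u′ + a * β ≈ t′ ⟧ ≡ ⟦ a ≈ x ⟧ ℕ.* ⟦ u′ + x * β ≈ t′ ⟧
    at-root a with a ≈? x
    ... | yes a≈x = ≡.cong (1 ℕ.*_) (⟦⟧-resp (+-congˡ (*-congʳ a≈x)) refl)
    ... | no _    = ≡.refl

module LinearForms (F : FiniteField) where

  open import Data.Nat as ℕ using (ℕ; suc)
  import Data.Nat.Properties as ℕ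
  import Relation.Binary.PropositionalEquality as ≡
  open ≡ using (_≡_)
  open ≡.≡-Reasoning
  open Sums
  open FiniteField F
  open AffineEquations F
  open CommutativeRingIdentities commRing
  open import Algebra.Properties.CommutativeSemigroup +-commutativeSemigroup using () renaming (x∙yz≈xz∙y to x+[y+z]≈x+z+y)

  dot : {E : Set} (es : List E) → (E → Carrier) → Vec Carrier (length es) → Carrier
  dot es w c = foldr _+_ 0# (zipWith (λ a e → a * w e) (toList c) es)

  dot-scale : ∀ {E} (es : List E) w α c → dot es (λ e → α * w e) c ≈ α * dot es w c
  dot-scale []       w α []      = sym (zeroʳ α)
  dot-scale (e ∷ es) w α (a ∷ c) = trans (+-congˡ (dot-scale es w α c)) (x[yz]+yw≈y[xz+w] a α (w e) (dot es w c))

  dot-zero : ∀ {E} (es : List E) c → dot es (λ _ → 0#) c ≈ 0#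
  dot-zero []       []      = refl
  dot-zero (e ∷ es) (a ∷ c) = trans (+-cong (zeroʳ a) (dot-zero es c)) (+-identityʳ 0#)

  ∑-allVecs-suc : ∀ n (f : Vec Carrier (suc n) → ℕ) →
    ∑ (allVecs F (suc n)) f ≡ ∑[ a ∈ elems ] ∑[ v ∈ allVecs F n ] f (a ∷ v)
  ∑-allVecs-suc n f = ≡.trans (∑-concatMap _ elems f) (∑-cong (λ a → ∑-map (a ∷_) (allVecs F n) f) elems)

  length-allVecs : ∀ n → length (allVecs F n) ≡ q F ℕ.^ n
  length-allVecs ℕ.zero  = ≡.refl
  length-allVecs (suc n) = begin
    length (allVecs F (suc n))                  ≡⟨ ∑-1 (allVecs F (suc n)) ⟨
    ∑ (allVecs F (suc n)) (λ _ → 1)             ≡⟨ ∑-allVecs-suc n (λ _ → 1) ⟩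
    ∑[ a ∈ elems ] ∑ (allVecs F n) (λ _ → 1)    ≡⟨ ∑-cong (λ _ → ≡.trans (∑-1 (allVecs F n)) (length-allVecs n)) elems ⟩
    ∑ elems (λ _ → q F ℕ.^ n)                   ≡⟨ ∑-const (q F ℕ.^ n) elems ⟩
    q F ℕ.^ n ℕ.* q F                           ≡⟨ ℕ.*-comm (q F ℕ.^ n) (q F) ⟩
    q F ℕ.^ suc n                               ∎

  #solutions : ∀ {E} (es : List E) (w₁ w₂ : E → Carrier) → Any (λ e → w₁ e ≉ w₂ e) es → ∀ s t →
    (∑[ c ∈ allVecs F (length es) ] ⟦ s + dot es w₁ c ≈ t + dot es w₂ c ⟧) ℕ.* q F ≡ q F ℕ.^ length es
  #solutions (e ∷ es) w₁ w₂ (here w₁e≉w₂e) s t = begin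
    (∑ (allVecs F (suc n)) (λ c → sol (e ∷ es) c)) ℕ.* q F
      ≡⟨ ≡.cong (ℕ._* q F) (≡.trans (∑-allVecs-suc n _) (∑-comm elems (allVecs F n) (λ a v → sol (e ∷ es) (a ∷ v)))) ⟩
    (∑[ v ∈ allVecs F n ] ∑[ a ∈ elems ] sol (e ∷ es) (a ∷ v)) ℕ.* q F
      ≡⟨ ≡.cong (ℕ._* q F) (∑-cong one-root (allVecs F n)) ⟩
    ∑ (allVecs F n) (λ _ → 1) ℕ.* q F
      ≡⟨ ≡.cong (ℕ._* q F) (≡.trans (∑-1 (allVecs F n)) (length-allVecs n)) ⟩
    q F ℕ.^ n ℕ.* q F
      ≡⟨ ℕ.*-comm (q F ℕ.^ n) (q F) ⟩
    q F ℕ.^ suc n ∎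
    where
    n = length es
    sol : ∀ es → Vec Carrier (length es) → ℕ
    sol es c = ⟦ s + dot es w₁ c ≈ t + dot es w₂ c ⟧
    one-root : ∀ v → ∑[ a ∈ elems ] sol (e ∷ es) (a ∷ v) ≡ 1
    one-root v = ≡.trans (∑-cong (λ a → ⟦⟧-resp (x+[y+z]≈x+z+y s _ _) (x+[y+z]≈x+z+y t _ _)) elems)
                         (∑⟦u+aα≈u′+aβ⟧≡1 w₁e≉w₂e _ _)
  #solutions (e ∷ es) w₁ w₂ (there w₁≉w₂) s t = begin
    (∑ (allVecs F (suc n)) (λ c → sol s t (e ∷ es) c)) ℕ.* q F
      ≡⟨ ≡.cong (ℕ._* q F) (∑-allVecs-suc n _) ⟩
    (∑[ a ∈ elems ] ∑[ v ∈ allVecs F n ] sol s t (e ∷ es) (a ∷ v)) ℕ.* q F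
      ≡⟨ ∑-*ʳ (q F) elems _ ⟨
    ∑[ a ∈ elems ] (∑[ v ∈ allVecs F n ] sol s t (e ∷ es) (a ∷ v)) ℕ.* q F
      ≡⟨ ∑-cong (λ a → ≡.trans (≡.cong (ℕ._* q F) (∑-cong (λ v → shift a v) (allVecs F n)))
                               (#solutions es w₁ w₂ w₁≉w₂ _ _)) elems ⟩
    ∑ elems (λ _ → q F ℕ.^ n)
      ≡⟨ ∑-const (q F ℕ.^ n) elems ⟩
    q F ℕ.^ n ℕ.* q F
      ≡⟨ ℕ.*-comm (q F ℕ.^ n) (q F) ⟩
    q F ℕ.^ suc n ∎
    where
    n = length es
    sol : Carrier → Carrier → ∀ es → Vec Carrier (length es) → ℕ
    sol s t es c = ⟦ s + dot es w₁ c ≈ t + dot es w₂ c ⟧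
    shift : ∀ a v → sol s t (e ∷ es) (a ∷ v) ≡ sol (s + a * w₁ e) (t + a * w₂ e) es v
    shift a v = ⟦⟧-resp (sym (+-assoc s _ _)) (sym (+-assoc t _ _))

  Nonvanishing : {E : Set} → (E → Carrier) → List E → Set
  Nonvanishing w es = Any (λ e → w e ≉ 0#) es

  Independent : {E : Set} → (E → Carrier) → (E → Carrier) → List E → Set
  Independent w w′ es = ∃₂ λ e f → e ∈ es × f ∈ es × w e * w′ f ≉ w′ e * w f

  private
    module Elimination {E : Set} (w w′ : E → Carrier) where

      sol : Carrier → Carrier → Carrier → Carrier → ∀ es → Vec Carrier (length es) → ℕ
      sol s s′ t t′ es c = ⟦ s + dot es w c ≈ t ⟧ ℕ.* ⟦ s′ + dot es w′ c ≈ t′ ⟧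

      -- Solving the first equation for the coordinate at e leaves one equation in the others.
      eliminate : ∀ e es {f} → w e ≉ 0# → f ∈ es → w e * w′ f ≉ w′ e * w f → ∀ s s′ t t′ →
        (∑ (allVecs F (suc (length es))) (sol s s′ t t′ (e ∷ es))) ℕ.* (q F ℕ.* q F) ≡ q F ℕ.^ suc (length es)
      eliminate e es {f} α≉0 f∈es minor s s′ t t′ = begin
        (∑ (allVecs F (suc n)) (sol s s′ t t′ (e ∷ es))) ℕ.* (q F ℕ.* q F)
          ≡⟨ ≡.cong (ℕ._* (q F ℕ.* q F)) (≡.trans (∑-allVecs-suc n _) (∑-comm elems (allVecs F n) _)) ⟩
        (∑[ v ∈ allVecs F n ] ∑[ a ∈ elems ] sol s s′ t t′ (e ∷ es) (a ∷ v)) ℕ.* (q F ℕ.* q F)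
          ≡⟨ ≡.cong (ℕ._* (q F ℕ.* q F)) (∑-cong remaining-equation (allVecs F n)) ⟩
        remaining ℕ.* (q F ℕ.* q F)
          ≡⟨ ℕ.*-assoc remaining (q F) (q F) ⟨
        remaining ℕ.* q F ℕ.* q F
          ≡⟨ ≡.cong (ℕ._* q F) (#solutions es w₁ w₂ (lose f∈es minor) _ _) ⟩
        q F ℕ.^ n ℕ.* q F
          ≡⟨ ℕ.*-comm (q F ℕ.^ n) (q F) ⟩
        q F ℕ.^ suc n ∎
        where
        n = length es
        α = w e
        β = w′ e
        w₁ w₂ : E → Carrier
        w₁ f = α * w′ f
        w₂ f = β * w f
        remaining : ℕ
        remaining = ∑[ v ∈ allVecs F n ] ⟦ (α * s′ + β * t) + dot es w₁ v ≈ (α * t′ + β * s) + dot es w₂ v ⟧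
        remaining-equation : ∀ v → ∑[ a ∈ elems ] sol s s′ t t′ (e ∷ es) (a ∷ v)
          ≡ ⟦ (α * s′ + β * t) + dot es w₁ v ≈ (α * t′ + β * s) + dot es w₂ v ⟧
        remaining-equation v = begin
          ∑[ a ∈ elems ] sol s s′ t t′ (e ∷ es) (a ∷ v)
            ≡⟨ ∑-cong (λ a → ≡.cong₂ ℕ._*_ (⟦⟧-resp (x+[y+z]≈x+z+y s _ _) refl)
                                            (⟦⟧-resp (x+[y+z]≈x+z+y s′ _ _) refl)) elems ⟩
          ∑[ a ∈ elems ] ⟦ (s + L) + a * α ≈ t ⟧ ℕ.* ⟦ (s′ + L′) + a * β ≈ t′ ⟧
            ≡⟨ ∑⟦u+aα≈t⟧⟦u′+aβ≈t′⟧ α≉0 β (s + L) (s′ + L′) t t′ ⟩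
          ⟦ α * (s′ + L′) + β * t ≈ α * t′ + β * (s + L) ⟧
            ≡⟨ ⟦⟧-resp (trans (x[y+z]+w≈xy+w+xz α s′ L′ (β * t)) (+-congˡ (sym (dot-scale es w′ α v))))
                       (trans (sym (x+yz+yw≈x+y[z+w] (α * t′) β s L)) (+-congˡ (sym (dot-scale es w β v)))) ⟩
          ⟦ (α * s′ + β * t) + dot es w₁ v ≈ (α * t′ + β * s) + dot es w₂ v ⟧ ∎
          where
          L = dot es w v
          L′ = dot es w′ v

  open Elimination using (sol; eliminate)

  private
    pivot : ∀ {E} e es (w w′ : E → Carrier) {f} → f ∈ es → w e * w′ f ≉ w′ e * w f → ∀ s s′ t t′ →
      (∑ (allVecs F (suc (length es))) (sol w w′ s s′ t t′ (e ∷ es))) ℕ.* (q F ℕ.* q F) ≡ q F ℕ.^ suc (length es)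
    pivot e es w w′ f∈es minor s s′ t t′ with w e ≈? 0#
    ... | no we≉0  = eliminate w w′ e es we≉0 f∈es minor s s′ t t′
    ... | yes we≈0 = ≡.trans (≡.cong (ℕ._* (q F ℕ.* q F)) (∑-cong swap (allVecs F (suc (length es)))))
                             (eliminate w′ w e es w′e≉0 f∈es (minor ∘ sym) s′ s t′ t)
      where
      swap : ∀ c → sol w w′ s s′ t t′ (e ∷ es) c ≡ sol w′ w s′ s t′ t (e ∷ es) c
      swap c = ℕ.*-comm ⟦ s + dot (e ∷ es) w c ≈ t ⟧ _
      w′e≉0 : w′ e ≉ 0#
      w′e≉0 w′e≈0 = minor (trans (*-congʳ we≈0) (trans (zeroˡ _) (sym (trans (*-congʳ w′e≈0) (zeroˡ _)))))

  #common-solutions : ∀ {E} (es : List E) (w w′ : E → Carrier) → Independent w w′ es → ∀ s s′ t t′ →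
    (∑[ c ∈ allVecs F (length es) ] ⟦ s + dot es w c ≈ t ⟧ ℕ.* ⟦ s′ + dot es w′ c ≈ t′ ⟧) ℕ.* (q F ℕ.* q F)
    ≡ q F ℕ.^ length es
  #common-solutions (e ∷ es) w w′ (_ , _ , here ≡.refl , here ≡.refl , minor) _ _ _ _ =
    ⊥-elim (minor (*-comm (w e) (w′ e)))
  #common-solutions (e ∷ es) w w′ (_ , _ , here ≡.refl , there f∈es , minor) s s′ t t′ =
    pivot e es w w′ f∈es minor s s′ t t′
  #common-solutions (e ∷ es) w w′ (f , _ , there f∈es , here ≡.refl , minor) s s′ t t′ =
    pivot e es w w′ f∈es (λ h → minor (trans (*-comm (w f) (w′ e)) (trans (sym h) (*-comm (w e) (w′ f))))) s s′ t t′
  #common-solutions (e ∷ es) w w′ (f , f′ , there f∈es , there f′∈es , minor) s s′ t t′ = begin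
    (∑ (allVecs F (suc n)) (sol w w′ s s′ t t′ (e ∷ es))) ℕ.* (q F ℕ.* q F)
      ≡⟨ ≡.cong (ℕ._* (q F ℕ.* q F)) (∑-allVecs-suc n _) ⟩
    (∑[ a ∈ elems ] ∑[ v ∈ allVecs F n ] sol w w′ s s′ t t′ (e ∷ es) (a ∷ v)) ℕ.* (q F ℕ.* q F)
      ≡⟨ ∑-*ʳ (q F ℕ.* q F) elems _ ⟨
    ∑[ a ∈ elems ] (∑[ v ∈ allVecs F n ] sol w w′ s s′ t t′ (e ∷ es) (a ∷ v)) ℕ.* (q F ℕ.* q F)
      ≡⟨ ∑-cong (λ a → ≡.trans (≡.cong (ℕ._* (q F ℕ.* q F)) (∑-cong (shift a) (allVecs F n)))
                               (#common-solutions es w w′ (f , f′ , f∈es , f′∈es , minor) _ _ t t′)) elems ⟩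
    ∑ elems (λ _ → q F ℕ.^ n)
      ≡⟨ ∑-const (q F ℕ.^ n) elems ⟩
    q F ℕ.^ n ℕ.* q F
      ≡⟨ ℕ.*-comm (q F ℕ.^ n) (q F) ⟩
    q F ℕ.^ suc n ∎
    where
    n = length es
    shift : ∀ a v → sol w w′ s s′ t t′ (e ∷ es) (a ∷ v) ≡ sol w w′ (s + a * w e) (s′ + a * w′ e) t t′ es v
    shift a v = ≡.cong₂ ℕ._*_ (⟦⟧-resp (sym (+-assoc s _ _)) refl) (⟦⟧-resp (sym (+-assoc s′ _ _)) refl)

  #zeros : ∀ {E} (es : List E) (w : E → Carrier) → Nonvanishing w es →
    (∑[ c ∈ allVecs F (length es) ] ⟦ dot es w c ≈ 0# ⟧) ℕ.* q F ≡ q F ℕ.^ length es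
  #zeros es w w≉0 = ≡.trans (≡.cong (ℕ._* q F) (∑-cong zero-offsets (allVecs F (length es))))
                            (#solutions es w (λ _ → 0#) w≉0 0# 0#)
    where
    zero-offsets : ∀ c → ⟦ dot es w c ≈ 0# ⟧ ≡ ⟦ 0# + dot es w c ≈ 0# + dot es (λ _ → 0#) c ⟧
    zero-offsets c = ⟦⟧-resp (sym (+-identityˡ _)) (sym (trans (+-identityˡ _) (dot-zero es c)))

  #common-zeros : ∀ {E} (es : List E) (w w′ : E → Carrier) → Independent w w′ es →
    (∑[ c ∈ allVecs F (length es) ] ⟦ dot es w c ≈ 0# ⟧ ℕ.* ⟦ dot es w′ c ≈ 0# ⟧) ℕ.* (q F ℕ.* q F) ≡ q F ℕ.^ length es
  #common-zeros es w w′ ind =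
    ≡.trans (≡.cong (ℕ._* (q F ℕ.* q F))
                    (∑-cong (λ c → ≡.cong₂ ℕ._*_ (zero-offset w c) (zero-offset w′ c)) (allVecs F (length es))))
            (#common-solutions es w w′ ind 0# 0# 0# 0#)
    where
    zero-offset : ∀ w c → ⟦ dot es w c ≈ 0# ⟧ ≡ ⟦ 0# + dot es w c ≈ 0# ⟧
    zero-offset w c = ⟦⟧-resp (sym (+-identityˡ _)) refl

module Tuples (F : FiniteField) where

  open import Data.Nat using (ℕ; _*_; _^_)
  open import Data.Nat.Properties using (*-comm; *-commutativeSemigroup)
  open import Data.Bool.Properties using (∧-commutativeMonoid)
  open import Algebra.Bundles using (CommutativeMonoid)
  open import Data.List.Properties using (map-tabulate)
  open import Relation.Binary.PropositionalEquality
  open ≡-Reasoning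
  open Sums
  open FiniteField F using (Carrier)
  open LinearForms F using (length-allVecs)
  open import Algebra.Properties.CommutativeSemigroup *-commutativeSemigroup using () renaming (interchange to *-interchange)
  open import Algebra.Properties.CommutativeSemigroup (CommutativeMonoid.commutativeSemigroup ∧-commutativeMonoid) using () renaming (interchange to ∧-interchange)

  allIdx-suc : ∀ r (p : Fin (ℕ.suc r) → Bool) → allIdx (ℕ.suc r) p ≡ p zero ∧ allIdx r (p ∘ suc)
  allIdx-suc r p = cong (λ ps → p zero ∧ foldr _∧_ true ps) (trans (map-tabulate suc p) (sym (map-tabulate id (p ∘ suc))))

  allIdx-∧ : ∀ r (p p′ : Fin r → Bool) → allIdx r p ∧ allIdx r p′ ≡ allIdx r (λ i → p i ∧ p′ i)
  allIdx-∧ ℕ.zero    p p′ = refl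
  allIdx-∧ (ℕ.suc r) p p′ rewrite allIdx-suc r p | allIdx-suc r p′ | allIdx-suc r (λ i → p i ∧ p′ i) =
    trans (∧-interchange (p zero) (allIdx r (p ∘ suc)) (p′ zero) (allIdx r (p′ ∘ suc)))
          (cong ((p zero ∧ p′ zero) ∧_) (allIdx-∧ r (p ∘ suc) (p′ ∘ suc)))

  module _ (r : ℕ) (D : Fin (ℕ.suc r) → ℕ) where

    ∑-allTuples-suc : ∀ f → ∑ (allTuples F (ℕ.suc r) D) f
      ≡ ∑[ v ∈ allVecs F (D zero) ] ∑[ t ∈ allTuples F r (D ∘ suc) ] f (consT F {D = D} v t)
    ∑-allTuples-suc f = trans (∑-concatMap _ (allVecs F (D zero)) f)
      (∑-cong (λ v → ∑-map (consT F {D = D} v) (allTuples F r (D ∘ suc)) f) (allVecs F (D zero)))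

    length-allTuples-suc : length (allTuples F (ℕ.suc r) D) ≡ q F ^ D zero * length (allTuples F r (D ∘ suc))
    length-allTuples-suc = begin
      length (allTuples F (ℕ.suc r) D)
        ≡⟨ ∑-1 (allTuples F (ℕ.suc r) D) ⟨
      ∑ (allTuples F (ℕ.suc r) D) (λ _ → 1)
        ≡⟨ ∑-allTuples-suc (λ _ → 1) ⟩
      ∑[ v ∈ allVecs F (D zero) ] ∑ (allTuples F r (D ∘ suc)) (λ _ → 1)
        ≡⟨ ∑-cong (λ _ → ∑-1 (allTuples F r (D ∘ suc))) (allVecs F (D zero)) ⟩
      ∑ (allVecs F (D zero)) (λ _ → length (allTuples F r (D ∘ suc)))
        ≡⟨ ∑-const _ (allVecs F (D zero)) ⟩
      length (allTuples F r (D ∘ suc)) * length (allVecs F (D zero))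
        ≡⟨ cong (length (allTuples F r (D ∘ suc)) *_) (length-allVecs (D zero)) ⟩
      length (allTuples F r (D ∘ suc)) * q F ^ D zero
        ≡⟨ *-comm _ (q F ^ D zero) ⟩
      q F ^ D zero * length (allTuples F r (D ∘ suc)) ∎

  ∑-allTuples-allIdx : ∀ r (D : Fin r → ℕ) (Pr : (i : Fin r) → Vec Carrier (D i) → Bool) K →
    (∀ i → (∑[ c ∈ allVecs F (D i) ] 𝟙 (Pr i c)) * K ≡ q F ^ D i) →
    (∑[ g ∈ allTuples F r D ] 𝟙 (allIdx r (λ i → Pr i (g i)))) * K ^ r ≡ length (allTuples F r D)
  ∑-allTuples-allIdx ℕ.zero    D Pr K pr = refl
  ∑-allTuples-allIdx (ℕ.suc r) D Pr K pr = begin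
    (∑[ g ∈ allTuples F (ℕ.suc r) D ] 𝟙 (allIdx (ℕ.suc r) (λ i → Pr i (g i)))) * (K * K ^ r)
      ≡⟨ cong (_* (K * K ^ r)) (trans (∑-allTuples-suc r D _) (∑-cong split (allVecs F (D zero)))) ⟩
    (∑[ v ∈ allVecs F (D zero) ] 𝟙 (Pr zero v) * rest) * (K * K ^ r)
      ≡⟨ cong (_* (K * K ^ r)) (∑-*ʳ rest (allVecs F (D zero)) (λ v → 𝟙 (Pr zero v))) ⟩
    first * rest * (K * K ^ r)
      ≡⟨ *-interchange first rest K (K ^ r) ⟩
    first * K * (rest * K ^ r)
      ≡⟨ cong₂ _*_ (pr zero) (∑-allTuples-allIdx r (D ∘ suc) (λ i → Pr (suc i)) K (λ i → pr (suc i))) ⟩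
    q F ^ D zero * length (allTuples F r (D ∘ suc))
      ≡⟨ length-allTuples-suc r D ⟨
    length (allTuples F (ℕ.suc r) D) ∎
    where
    first = ∑[ v ∈ allVecs F (D zero) ] 𝟙 (Pr zero v)
    rest = ∑[ t ∈ allTuples F r (D ∘ suc) ] 𝟙 (allIdx r (λ i → Pr (suc i) (t i)))
    split : ∀ v → ∑[ t ∈ allTuples F r (D ∘ suc) ] 𝟙 (allIdx (ℕ.suc r) (λ i → Pr i (consT F {D = D} v t i)))
                ≡ 𝟙 (Pr zero v) * rest
    split v = trans (∑-cong (λ t → trans (cong 𝟙 (allIdx-suc r _)) (𝟙-∧ (Pr zero v) _)) (allTuples F r (D ∘ suc)))
                    (∑-*ˡ (𝟙 (Pr zero v)) (allTuples F r (D ∘ suc)) _)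

module Monomials (F : FiniteField) where

  open import Data.Nat as ℕ using (ℕ; s≤s)
  import Data.Nat.Properties as ℕ
  open import Data.Vec using (sum)
  import Data.Fin.Properties as Fin
  open import Data.List.Membership.Propositional.Properties using (∈-concatMap⁺; ∈-map⁺; ∈-upTo⁺)
  import Relation.Binary.PropositionalEquality as ≡
  open ≡ using (_≡_)
  open FiniteField F
  open AffineEquations F using (*-≉0; *-cancelʳ-≉0; _⁻¹[_]; ⁻¹-inverseʳ)
  open LinearForms F using (Nonvanishing; Independent)
  open import Algebra.Properties.CommutativeSemigroup *-commutativeSemigroup using (interchange; xy∙z≈yz∙x; xy∙z≈xz∙y)
  open import Relation.Binary.Reasoning.Setoid setoid

  ∈-monos : ∀ {n m} (e : Vec ℕ n) → sum e ≡ m → e ∈ monos n m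
  ∈-monos []      ≡.refl = here ≡.refl
  ∈-monos (k ∷ e) ≡.refl = ∈-concatMap⁺ _ (lose (∈-upTo⁺ (s≤s (ℕ.m≤m+n k (sum e))))
    (∈-map⁺ (k ∷_) (∈-monos e (≡.sym (ℕ.m+n∸m≡n k (sum e))))))

  veronese : ∀ {n} → Vec Carrier n → Vec ℕ n → Carrier
  veronese y e = monoVal F e y

  x[_]^_ : ∀ {n} → Fin n → ℕ → Vec ℕ n
  x[ i ]^ ℕ.zero  = replicate _ 0
  x[ i ]^ ℕ.suc k = updateAt (x[ i ]^ k) i ℕ.suc

  sum-updateAt-suc : ∀ {n} (e : Vec ℕ n) i → sum (updateAt e i ℕ.suc) ≡ ℕ.suc (sum e)
  sum-updateAt-suc (k ∷ e) zero    = ≡.refl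
  sum-updateAt-suc (k ∷ e) (suc i) = ≡.trans (≡.cong (k ℕ.+_) (sum-updateAt-suc e i)) (ℕ.+-suc k (sum e))

  veronese-updateAt-suc : ∀ {n} (y : Vec Carrier n) e i → veronese y (updateAt e i ℕ.suc) ≈ veronese y e * lookup y i
  veronese-updateAt-suc (x ∷ y) (k ∷ e) zero    = xy∙z≈yz∙x x (pow F x k) (veronese y e)
  veronese-updateAt-suc (x ∷ y) (k ∷ e) (suc i) =
    trans (*-congˡ (veronese-updateAt-suc y e i)) (sym (*-assoc (pow F x k) _ _))

  sum-x^ : ∀ {n} (i : Fin n) k → sum (x[ i ]^ k) ≡ k
  sum-x^ {n} i ℕ.zero    = sum-zeros n
    where
    sum-zeros : ∀ n → sum (replicate n 0) ≡ 0
    sum-zeros ℕ.zero    = ≡.refl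
    sum-zeros (ℕ.suc n) = sum-zeros n
  sum-x^ i (ℕ.suc k) = ≡.trans (sum-updateAt-suc (x[ i ]^ k) i) (≡.cong ℕ.suc (sum-x^ i k))

  x^∈monos : ∀ {n} (i : Fin n) k → x[ i ]^ k ∈ monos n k
  x^∈monos i k = ∈-monos (x[ i ]^ k) (sum-x^ i k)

  veronese-x^ : ∀ {n} (y : Vec Carrier n) i k → veronese y (x[ i ]^ k) ≈ pow F (lookup y i) k
  veronese-x^ y i ℕ.zero    = veronese-zeros y
    where
    veronese-zeros : ∀ {n} (y : Vec Carrier n) → veronese y (replicate n 0) ≈ 1#
    veronese-zeros []      = refl
    veronese-zeros (x ∷ y) = trans (*-identityˡ _) (veronese-zeros y)
  veronese-x^ y i (ℕ.suc k) = begin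
    veronese y (x[ i ]^ ℕ.suc k)          ≈⟨ veronese-updateAt-suc y (x[ i ]^ k) i ⟩
    veronese y (x[ i ]^ k) * lookup y i   ≈⟨ *-congʳ (veronese-x^ y i k) ⟩
    pow F (lookup y i) k * lookup y i     ≈⟨ *-comm _ (lookup y i) ⟩
    pow F (lookup y i) (ℕ.suc k)          ∎

  pow-≉0 : ∀ {x} → x ≉ 0# → ∀ k → pow F x k ≉ 0#
  pow-≉0 x≉0 ℕ.zero    1≈0 = 0≉1 (sym 1≈0)
  pow-≉0 x≉0 (ℕ.suc k)     = *-≉0 x≉0 (pow-≉0 x≉0 k)

  nonzero-coordinate : ∀ {n} (y : Vec Carrier n) → NonZeroVec F y → ∃ λ i → lookup y i ≉ 0#
  nonzero-coordinate {n} y y≢0 = Fin.¬∀⟶∃¬ n (λ i → lookup y i ≈ 0#) (λ i → lookup y i ≈? 0#) y≢0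

  veronese-nonvanishing : ∀ {n} {y : Vec Carrier n} → NonZeroVec F y → ∀ m → Nonvanishing (veronese y) (monos n m)
  veronese-nonvanishing {y = y} y≢0 m with nonzero-coordinate y y≢0
  ... | i , yᵢ≉0 = lose (x^∈monos i m) (λ h → pow-≉0 yᵢ≉0 m (trans (sym (veronese-x^ y i m)) h))

  module _ {n} {y z : Vec Carrier n} {i : Fin n} (yᵢ≉0 : lookup y i ≉ 0#) where

    independent-if-zᵢ≈0 : ∀ m {j} → lookup z i ≈ 0# → lookup z j ≉ 0# →
      Independent (veronese y) (veronese z) (monos n (ℕ.suc m))
    independent-if-zᵢ≈0 m {j} zᵢ≈0 zⱼ≉0 =
      x[ i ]^ ℕ.suc m , x[ j ]^ ℕ.suc m , x^∈monos i _ , x^∈monos j _ , λ h →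
        *-≉0 (pow-≉0 yᵢ≉0 (ℕ.suc m)) (pow-≉0 zⱼ≉0 (ℕ.suc m)) (begin
          pow F (lookup y i) (ℕ.suc m) * pow F (lookup z j) (ℕ.suc m)
            ≈⟨ *-cong (veronese-x^ y i (ℕ.suc m)) (veronese-x^ z j (ℕ.suc m)) ⟨
          veronese y (x[ i ]^ ℕ.suc m) * veronese z (x[ j ]^ ℕ.suc m)
            ≈⟨ h ⟩
          veronese z (x[ i ]^ ℕ.suc m) * veronese y (x[ j ]^ ℕ.suc m)
            ≈⟨ *-congʳ (trans (veronese-x^ z i (ℕ.suc m)) (trans (*-congʳ zᵢ≈0) (zeroˡ _))) ⟩
          0# * veronese y (x[ j ]^ ℕ.suc m)
            ≈⟨ zeroˡ _ ⟩
          0# ∎)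

    proportional-if-minors≈0 : lookup z i ≉ 0# →
      (∀ l → lookup y i * lookup z l ≈ lookup y l * lookup z i) → Proportional F y z
    proportional-if-minors≈0 zᵢ≉0 minors≈0 = c , *-≉0 zᵢ≉0 yᵢ⁻¹≉0 , λ l → *-cancelʳ-≉0 yᵢ≉0 (begin
      lookup z l * lookup y i                        ≈⟨ *-comm _ _ ⟩
      lookup y i * lookup z l                        ≈⟨ minors≈0 l ⟩
      lookup y l * lookup z i                        ≈⟨ *-comm _ _ ⟩
      lookup z i * lookup y l                        ≈⟨ *-identityʳ _ ⟨
      lookup z i * lookup y l * 1#                   ≈⟨ *-congˡ (trans (*-comm _ _) (⁻¹-inverseʳ yᵢ≉0)) ⟨
      lookup z i * lookup y l * (yᵢ⁻¹ * lookup y i)  ≈⟨ *-assoc _ _ _ ⟨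
      lookup z i * lookup y l * yᵢ⁻¹ * lookup y i    ≈⟨ *-congʳ (xy∙z≈xz∙y _ _ _) ⟩
      c * lookup y l * lookup y i                    ∎)
      where
      yᵢ⁻¹ = lookup y i ⁻¹[ yᵢ≉0 ]
      c = lookup z i * yᵢ⁻¹
      yᵢ⁻¹≉0 : yᵢ⁻¹ ≉ 0#
      yᵢ⁻¹≉0 h = 0≉1 (trans (sym (zeroʳ (lookup y i))) (trans (*-congˡ (sym h)) (⁻¹-inverseʳ yᵢ≉0)))

    -- The monomials xᵢ^m·xᵢ and xᵢ^m·xₗ turn the minor yᵢ zₗ − yₗ zᵢ into yᵢ^m zᵢ^m (yᵢ zₗ − yₗ zᵢ).
    independent-if-minor≉0 : ∀ m {l} → lookup z i ≉ 0# → lookup y i * lookup z l ≉ lookup y l * lookup z i →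
      Independent (veronese y) (veronese z) (monos n (ℕ.suc m))
    independent-if-minor≉0 m {l} zᵢ≉0 minor≉0 =
      x[ i ]^ ℕ.suc m , xᵢ^m·xₗ , x^∈monos i _ , ∈-monos xᵢ^m·xₗ sum-xᵢ^m·xₗ , λ h → minor≉0 (*-cancelʳ-≉0 YZ≉0 (begin
        lookup y i * lookup z l * (Y * Z)   ≈⟨ interchange _ _ _ _ ⟩
        lookup y i * Y * (lookup z l * Z)   ≈⟨ *-cong (*-comm _ _) (*-comm _ _) ⟩
        Y * lookup y i * (Z * lookup z l)   ≈⟨ *-cong (veronese-updateAt-suc y (x[ i ]^ m) i) (veronese-updateAt-suc z (x[ i ]^ m) l) ⟨
        _                                   ≈⟨ h ⟩
        veronese z (x[ i ]^ ℕ.suc m) * veronese y xᵢ^m·xₗ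
          ≈⟨ *-cong (veronese-updateAt-suc z (x[ i ]^ m) i) (veronese-updateAt-suc y (x[ i ]^ m) l) ⟩
        Z * lookup z i * (Y * lookup y l)   ≈⟨ *-comm _ _ ⟩
        Y * lookup y l * (Z * lookup z i)   ≈⟨ interchange _ _ _ _ ⟩
        Y * Z * (lookup y l * lookup z i)   ≈⟨ *-comm _ _ ⟩
        lookup y l * lookup z i * (Y * Z)   ∎))
      where
      xᵢ^m·xₗ = updateAt (x[ i ]^ m) l ℕ.suc
      sum-xᵢ^m·xₗ : sum xᵢ^m·xₗ ≡ ℕ.suc m
      sum-xᵢ^m·xₗ = ≡.trans (sum-updateAt-suc (x[ i ]^ m) l) (≡.cong ℕ.suc (sum-x^ i m))
      Y = veronese y (x[ i ]^ m)
      Z = veronese z (x[ i ]^ m)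
      YZ≉0 : Y * Z ≉ 0#
      YZ≉0 = *-≉0 (λ h → pow-≉0 yᵢ≉0 m (trans (sym (veronese-x^ y i m)) h))
                  (λ h → pow-≉0 zᵢ≉0 m (trans (sym (veronese-x^ z i m)) h))

  proportional-or-independent : ∀ {n m} {y z : Vec Carrier n} → 1 ℕ.≤ m → NonZeroVec F y → NonZeroVec F z →
    Proportional F y z ⊎ Independent (veronese y) (veronese z) (monos n m)
  proportional-or-independent {n} {ℕ.suc m} {y} {z} (s≤s _) y≢0 z≢0 with nonzero-coordinate y y≢0
  ... | i , yᵢ≉0 with lookup z i ≈? 0#
  ...   | yes zᵢ≈0 = inj₂ (independent-if-zᵢ≈0 {y = y} {z} {i} yᵢ≉0 m zᵢ≈0 (proj₂ (nonzero-coordinate z z≢0)))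
  ...   | no zᵢ≉0 with Fin.all? (λ l → (lookup y i * lookup z l) ≈? (lookup y l * lookup z i))
  ...     | yes minors≈0 = inj₁ (proportional-if-minors≈0 {y = y} {z} {i} yᵢ≉0 zᵢ≉0 minors≈0)
  ...     | no ¬minors≈0 with Fin.¬∀⟶∃¬ n _ (λ l → (lookup y i * lookup z l) ≈? (lookup y l * lookup z i)) ¬minors≈0
  ...       | _ , minor≉0 = inj₂ (independent-if-minor≉0 {y = y} {z} {i} yᵢ≉0 m zᵢ≉0 minor≉0)

module ProductWeights (F : FiniteField) where

  open FiniteField F
  open AffineEquations F using (*-≉0; *-cancelʳ-≉0)
  open LinearForms F using (Nonvanishing; Independent)
  open import Data.List.Membership.Propositional.Properties using (∈-cartesianProduct⁺; ∈-cartesianProduct⁻)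
  open import Algebra.Properties.CommutativeSemigroup *-commutativeSemigroup using (interchange)
  open import Relation.Binary.Reasoning.Setoid setoid

  _⊗_ : {E₁ E₂ : Set} → (E₁ → Carrier) → (E₂ → Carrier) → E₁ × E₂ → Carrier
  (u ⊗ v) p = u (proj₁ p) * v (proj₂ p)

  ⊗-nonvanishing : ∀ {E₁ E₂} {L₁ : List E₁} {L₂ : List E₂} {u v} →
    Nonvanishing u L₁ → Nonvanishing v L₂ → Nonvanishing (u ⊗ v) (cartesianProduct L₁ L₂)
  ⊗-nonvanishing u≉0 v≉0 with find u≉0 | find v≉0
  ... | e , e∈L₁ , ue≉0 | f , f∈L₂ , vf≉0 = lose (∈-cartesianProduct⁺ e∈L₁ f∈L₂) (*-≉0 ue≉0 vf≉0)

  ⊗-independent-column : ∀ {E₁ E₂} {L₁ : List E₁} {L₂ : List E₂} {u u′ v v′} {g} →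
    Independent u u′ L₁ → g ∈ L₂ → v g ≉ 0# → v′ g ≉ 0# → Independent (u ⊗ v) (u′ ⊗ v′) (cartesianProduct L₁ L₂)
  ⊗-independent-column {u = u} {u′} {v} {v′} {g} (e₁ , e₂ , e₁∈L₁ , e₂∈L₁ , minor) g∈L₂ vg≉0 v′g≉0 =
    (e₁ , g) , (e₂ , g) , ∈-cartesianProduct⁺ e₁∈L₁ g∈L₂ , ∈-cartesianProduct⁺ e₂∈L₁ g∈L₂ ,
    λ h → minor (*-cancelʳ-≉0 (*-≉0 vg≉0 v′g≉0) (begin
      u e₁ * u′ e₂ * (v g * v′ g)    ≈⟨ interchange _ _ _ _ ⟩
      u e₁ * v g * (u′ e₂ * v′ g)    ≈⟨ h ⟩
      u′ e₁ * v′ g * (u e₂ * v g)    ≈⟨ interchange _ _ _ _ ⟩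
      u′ e₁ * u e₂ * (v′ g * v g)    ≈⟨ *-congˡ (*-comm _ _) ⟩
      u′ e₁ * u e₂ * (v g * v′ g)    ∎))

  -- Either one of the columns f (v f ≠ 0), f′ (v′ f′ ≠ 0) has both entries nonzero and carries the minor
  -- of u, u′, or v′ f = 0 and the cells (e, f), (e′, f′) with u e ≠ 0, u′ e′ ≠ 0 give a minor with one
  -- side zero and the other not.
  ⊗-independentˡ : ∀ {E₁ E₂} {L₁ : List E₁} {L₂ : List E₂} {u u′ v v′} →
    Independent u u′ L₁ → Nonvanishing u L₁ → Nonvanishing u′ L₁ → Nonvanishing v L₂ → Nonvanishing v′ L₂ →
    Independent (u ⊗ v) (u′ ⊗ v′) (cartesianProduct L₁ L₂)
  ⊗-independentˡ {v = v} {v′} ind u≉0 u′≉0 v≉0 v′≉0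
    with find u≉0 | find u′≉0 | find v≉0 | find v′≉0
  ... | e , e∈L₁ , ue≉0 | e′ , e′∈L₁ , u′e′≉0 | f , f∈L₂ , vf≉0 | f′ , f′∈L₂ , v′f′≉0
    with v′ f ≈? 0# | v f′ ≈? 0#
  ...   | no v′f≉0  | _         = ⊗-independent-column ind f∈L₂ vf≉0 v′f≉0
  ...   | yes _     | no vf′≉0  = ⊗-independent-column ind f′∈L₂ vf′≉0 v′f′≉0
  ...   | yes v′f≈0 | yes _     =
    (e , f) , (e′ , f′) , ∈-cartesianProduct⁺ e∈L₁ f∈L₂ , ∈-cartesianProduct⁺ e′∈L₁ f′∈L₂ ,
    λ h → *-≉0 (*-≉0 ue≉0 vf≉0) (*-≉0 u′e′≉0 v′f′≉0)
               (trans h (trans (*-congʳ (trans (*-congˡ v′f≈0) (zeroʳ _))) (zeroˡ _)))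

  ⊗-independent-swap : ∀ {E₁ E₂} {L₁ : List E₁} {L₂ : List E₂} {u u′ v v′} →
    Independent (v ⊗ u) (v′ ⊗ u′) (cartesianProduct L₂ L₁) → Independent (u ⊗ v) (u′ ⊗ v′) (cartesianProduct L₁ L₂)
  ⊗-independent-swap {L₁ = L₁} {L₂} ((f₁ , e₁) , (f₂ , e₂) , m₁ , m₂ , minor) =
    (e₁ , f₁) , (e₂ , f₂) , swap m₁ , swap m₂ ,
    λ h → minor (trans (*-cong (*-comm _ _) (*-comm _ _)) (trans h (*-cong (*-comm _ _) (*-comm _ _))))
    where
    swap : ∀ {f e} → (f , e) ∈ cartesianProduct L₂ L₁ → (e , f) ∈ cartesianProduct L₁ L₂
    swap m = ∈-cartesianProduct⁺ (proj₂ (∈-cartesianProduct⁻ L₂ L₁ m)) (proj₁ (∈-cartesianProduct⁻ L₂ L₁ m))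

  ⊗-independent : ∀ {E₁ E₂} {L₁ : List E₁} {L₂ : List E₂} {u u′ v v′} →
    Independent u u′ L₁ ⊎ Independent v v′ L₂ →
    Nonvanishing u L₁ → Nonvanishing u′ L₁ → Nonvanishing v L₂ → Nonvanishing v′ L₂ →
    Independent (u ⊗ v) (u′ ⊗ v′) (cartesianProduct L₁ L₂)
  ⊗-independent (inj₁ ind) u≉0 u′≉0 v≉0 v′≉0 = ⊗-independentˡ ind u≉0 u′≉0 v≉0 v′≉0
  ⊗-independent {L₁ = L₁} {L₂} (inj₂ ind) u≉0 u′≉0 v≉0 v′≉0 =
    ⊗-independent-swap {L₁ = L₁} {L₂} (⊗-independentˡ ind v≉0 v′≉0 u≉0 u′≉0)

AllPairs-zipWith-All : {A : Set} {P : A → Set} {R S : A → A → Set} →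
  (∀ {x y} → P x → P y → R x y → S x y) → ∀ {xs} → All P xs → AllPairs R xs → AllPairs S xs
AllPairs-zipWith-All f []         []         = []
AllPairs-zipWith-All f (px ∷ pxs) (rx ∷ rxs) =
  All.map (λ { (py , r) → f px py r }) (All.zip (pxs , rx)) ∷ AllPairs-zipWith-All f pxs rxs

open import Data.Nat using (ℕ; zero; suc; _*_; _^_; _≤_; _≤ᵇ_)
open import Data.Nat.Properties using (*-commutativeSemigroup)
open import Algebra.Properties.CommutativeSemigroup *-commutativeSemigroup using (interchange)
open import Relation.Binary.PropositionalEquality using (_≡_; refl; sym; trans; cong; cong₂; subst; module ≡-Reasoning)
open Sums using (∑; 𝟙; 𝟙-∧; ∑-cong; length-filterᵇ)
open SecondMoment using (second-moment-method; Pr≡1/K; Pr≡1/K²)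

^-distribʳ-* : ∀ m n o → (m * n) ^ o ≡ m ^ o * n ^ o
^-distribʳ-* m n zero    = refl
^-distribʳ-* m n (suc o) = trans (cong (m * n *_) (^-distribʳ-* m n o)) (interchange m n (m ^ o) (n ^ o))

module _ (F : FiniteField) where

  open FiniteField F using (Carrier)
  open LinearForms F using (dot; Nonvanishing; Independent; #zeros; #common-zeros)
  open Tuples F using (allIdx-∧; ∑-allTuples-allIdx)
  open Monomials F using (veronese; veronese-nonvanishing; proportional-or-independent)
  open ProductWeights F using (_⊗_; ⊗-nonvanishing; ⊗-independent)

  random-forms-bound : ∀ r {E P : Set} (es : Fin r → List E) (w : P → Fin r → E → Carrier) (Y : List P) →
    All (λ p → ∀ i → Nonvanishing (w p i) (es i)) Y →
    AllPairs (λ p p′ → ∀ i → Independent (w p i) (w p′ i) (es i)) Y →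
    1 ≤ length Y →
    count F (λ g → (2 * q F ^ r) * count F (λ p → allIdx r (λ i → isZero F (dot (es i) (w p i) (g i)))) Y ≤ᵇ length Y)
            (allTuples F r (λ i → length (es i)))
      * length Y
    ≤ (4 * q F ^ r) * length (allTuples F r (λ i → length (es i)))
  random-forms-bound r {P = P} es w Y nonvanishing independent 1≤|Y| =
    subst (λ n → n * length Y ≤ 4 * q F ^ r * length S) (sym count≡∑)
          (second-moment-method S A (q F ^ r) Y (All.map marginal nonvanishing) (AllPairs.map pairwise independent) 1≤|Y|)
    where
    S = allTuples F r (λ i → length (es i))
    A : P → ((i : Fin r) → Vec Carrier (length (es i))) → Bool
    A p g = allIdx r (λ i → isZero F (dot (es i) (w p i) (g i)))
    count≡∑ : count F (λ g → 2 * q F ^ r * count F (λ p → A p g) Y ≤ᵇ length Y) S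
            ≡ ∑[ g ∈ S ] 𝟙 (2 * q F ^ r * (∑[ p ∈ Y ] 𝟙 (A p g)) ≤ᵇ length Y)
    count≡∑ = trans (length-filterᵇ _ S)
      (∑-cong (λ g → cong (λ n → 𝟙 (2 * q F ^ r * n ≤ᵇ length Y)) (length-filterᵇ (λ p → A p g) Y)) S)
    marginal : ∀ {p} → (∀ i → Nonvanishing (w p i) (es i)) → Pr≡1/K S A (q F ^ r) p
    marginal {p} w≉0 = ∑-allTuples-allIdx r _ _ (q F) (λ i → #zeros (es i) (w p i) (w≉0 i))
    pairwise : ∀ {p p′} → (∀ i → Independent (w p i) (w p′ i) (es i)) → Pr≡1/K² S A (q F ^ r) p p′
    pairwise {p} {p′} ind = begin
      (∑[ g ∈ S ] 𝟙 (A p g ∧ A p′ g)) * (q F ^ r * q F ^ r)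
        ≡⟨ cong₂ _*_ (∑-cong (λ g → cong 𝟙 (allIdx-∧ r _ _)) S) (sym (^-distribʳ-* (q F) (q F) r)) ⟩
      (∑[ g ∈ S ] 𝟙 (allIdx r (λ i → both i (g i)))) * (q F * q F) ^ r
        ≡⟨ ∑-allTuples-allIdx r _ both (q F * q F) (λ i →
             trans (cong (_* (q F * q F)) (∑-cong (λ c → 𝟙-∧ (isZero F (dot (es i) (w p i) c)) _) (allVecs F (length (es i)))))
                   (#common-zeros (es i) (w p i) (w p′ i) (ind i))) ⟩
      length S ∎
      where
      open ≡-Reasoning
      both : (i : Fin r) → Vec Carrier (length (es i)) → Bool
      both i c = isZero F (dot (es i) (w p i) c) ∧ isZero F (dot (es i) (w p′ i) c)

  homogeneous-bound : (b r : ℕ) (m : Fin r → ℕ) → (∀ i → 1 ≤ m i) →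
    (Y : List (Vec (FiniteField.Carrier F) (suc b))) →
    All (NonZeroVec F) Y → AllPairs (λ x y → ¬ Proportional F x y) Y →
    1 ≤ length Y →
    count F (λ g → (2 * q F ^ r) * count F (λ y → allIdx r (λ i → isZero F (evalHom F (g i) y))) Y
                   ≤ᵇ length Y)
            (allTuples F r (λ i → length (monos (suc b) (m i))))
      * length Y
    ≤ (4 * q F ^ r) * length (allTuples F r (λ i → length (monos (suc b) (m i))))
  homogeneous-bound b r m m≥1 Y Y≢0 Y-distinct =
    random-forms-bound r (λ i → monos (suc b) (m i)) (λ y i → veronese y) Y
      (All.map (λ y≢0 i → veronese-nonvanishing y≢0 (m i)) Y≢0)
      (AllPairs-zipWith-All independent Y≢0 Y-distinct)
    where
    independent : ∀ {y z} → NonZeroVec F y → NonZeroVec F z → ¬ Proportional F y z →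
      ∀ i → Independent (veronese y) (veronese z) (monos (suc b) (m i))
    independent y≢0 z≢0 y≁z i with proportional-or-independent (m≥1 i) y≢0 z≢0
    ... | inj₁ y∼z = ⊥-elim (y≁z y∼z)
    ... | inj₂ ind = ind

  bihomogeneous-bound : (a b r : ℕ) (m m′ : Fin r → ℕ) → (∀ i → 1 ≤ m i) → (∀ i → 1 ≤ m′ i) →
    (Y : List (Vec (FiniteField.Carrier F) (suc a) × Vec (FiniteField.Carrier F) (suc b))) →
    All (λ p → NonZeroVec F (proj₁ p) × NonZeroVec F (proj₂ p)) Y →
    AllPairs (λ p p′ → ¬ (Proportional F (proj₁ p) (proj₁ p′) × Proportional F (proj₂ p) (proj₂ p′))) Y →
    1 ≤ length Y →
    count F (λ g → (2 * q F ^ r) * count F (λ p → allIdx r (λ i → isZero F (evalBi F (g i) (proj₁ p) (proj₂ p)))) Y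
                   ≤ᵇ length Y)
            (allTuples F r (λ i → length (biMonos F (suc a) (m i) (suc b) (m′ i))))
      * length Y
    ≤ (4 * q F ^ r) * length (allTuples F r (λ i → length (biMonos F (suc a) (m i) (suc b) (m′ i))))
  bihomogeneous-bound a b r m m′ m≥1 m′≥1 Y Y≢0 Y-distinct =
    random-forms-bound r (λ i → biMonos F (suc a) (m i) (suc b) (m′ i)) (λ p i → veronese (proj₁ p) ⊗ veronese (proj₂ p)) Y
      (All.map (λ { (x≢0 , y≢0) i →
                     ⊗-nonvanishing (veronese-nonvanishing x≢0 (m i)) (veronese-nonvanishing y≢0 (m′ i)) }) Y≢0)
      (AllPairs-zipWith-All independent Y≢0 Y-distinct)
    where
    independent : ∀ {p p′} → NonZeroVec F (proj₁ p) × NonZeroVec F (proj₂ p) →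
      NonZeroVec F (proj₁ p′) × NonZeroVec F (proj₂ p′) →
      ¬ (Proportional F (proj₁ p) (proj₁ p′) × Proportional F (proj₂ p) (proj₂ p′)) →
      ∀ i → Independent (veronese (proj₁ p) ⊗ veronese (proj₂ p)) (veronese (proj₁ p′) ⊗ veronese (proj₂ p′))
                        (biMonos F (suc a) (m i) (suc b) (m′ i))
    independent (x≢0 , y≢0) (x′≢0 , y′≢0) p≁p′ i
      with proportional-or-independent (m≥1 i) x≢0 x′≢0 | proportional-or-independent (m′≥1 i) y≢0 y′≢0
    ... | inj₁ x∼x′ | inj₁ y∼y′ = ⊥-elim (p≁p′ (x∼x′ , y∼y′))
    ... | inj₂ ind  | _         = ⊗-independent (inj₁ ind) x-nv x′-nv y-nv y′-nv
      where
      x-nv = veronese-nonvanishing x≢0 (m i)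
      x′-nv = veronese-nonvanishing x′≢0 (m i)
      y-nv = veronese-nonvanishing y≢0 (m′ i)
      y′-nv = veronese-nonvanishing y′≢0 (m′ i)
    ... | inj₁ _    | inj₂ ind  = ⊗-independent (inj₂ ind) x-nv x′-nv y-nv y′-nv
      where
      x-nv = veronese-nonvanishing x≢0 (m i)
      x′-nv = veronese-nonvanishing x′≢0 (m i)
      y-nv = veronese-nonvanishing y≢0 (m′ i)
      y′-nv = veronese-nonvanishing y′≢0 (m′ i)

lemma4 : (F : FiniteField) →
    -- (a) Y ⊆ P^b(F_q), homogeneous g_i of degree m_i ≥ 1
    ((b r : ℕ) (m : Fin r → ℕ) → (∀ i → 1 ≤ m i) →
     (Y : List (Vec (FiniteField.Carrier F) (suc b))) →
     All (NonZeroVec F) Y → AllPairs (λ x y → ¬ Proportional F x y) Y →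
     1 ≤ length Y →
     count F (λ g → (2 * q F ^ r) * count F (λ y → allIdx r (λ i → isZero F (evalHom F (g i) y))) Y
                    ≤ᵇ length Y)
             (allTuples F r (λ i → length (monos (suc b) (m i))))
       * length Y
     ≤ (4 * q F ^ r) * length (allTuples F r (λ i → length (monos (suc b) (m i)))))
    ×
    -- (b) Y ⊆ P^a(F_q) × P^b(F_q), bihomogeneous g_i of bidegree (m_i , m'_i), m_i , m'_i ≥ 1
    ((a b r : ℕ) (m m' : Fin r → ℕ) → (∀ i → 1 ≤ m i) → (∀ i → 1 ≤ m' i) →
     (Y : List (Vec (FiniteField.Carrier F) (suc a) × Vec (FiniteField.Carrier F) (suc b))) →
     All (λ p → NonZeroVec F (proj₁ p) × NonZeroVec F (proj₂ p)) Y →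
     AllPairs (λ p p' → ¬ (Proportional F (proj₁ p) (proj₁ p') × Proportional F (proj₂ p) (proj₂ p'))) Y →
     1 ≤ length Y →
     count F (λ g → (2 * q F ^ r) * count F (λ p → allIdx r (λ i → isZero F (evalBi F (g i) (proj₁ p) (proj₂ p)))) Y
                    ≤ᵇ length Y)
             (allTuples F r (λ i → length (biMonos F (suc a) (m i) (suc b) (m' i))))
       * length Y
     ≤ (4 * q F ^ r) * length (allTuples F r (λ i → length (biMonos F (suc a) (m i) (suc b) (m' i)))))
lemma4 F = homogeneous-bound F , bihomogeneous-bound F
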